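{- Let $q\ge3$ and $a\le d-2$ (notation as in the context). Then (a) $|\lambda_1^a|-|\lambda_d^a|$ is $>0$ if $\epsilon>1$, $=0$ if $\epsilon=1$, and $<0$ if $\epsilon<1$; (b) if $d\ge3$, then $|\lambda_1^a|\ge|\lambda_{d-1}^a|$ and $|\lambda_d^a|\ge|\lambda_{d-1}^a|$.
   Context: For a finite classical polar space of rank $d$, order $q$ and type $\epsilon$ ($\epsilon=0,\frac12,1,1,\frac32,2$ for $Q^+(2d-1,q)$, $H(2d-1,q)$, $Q(2d,q)$, $W(2d-1,q)$, $H(2d,q)$, $Q^-(2d+1,q)$), $A_i$ is the adjacency matrix on generators with $(A_i)_{xy}=1$ iff $d-\dim(x\cap y)=i$; they have common eigenspaces $V_0,\dots,V_d$ on which $A_s$ acts as $P_{r,s}=\sum_{t=\max(r-s,0)}^{\min(d-s,r)}(-1)^{r-t}\genfrac{[}{]}{0pt}{}{d-r}{d-s-t}_q\genfrac{[}{]}{0pt}{}{r}{t}_q q^{\binom{r-t}{2}+\binom{s-r+t}{2}+(s-r+t)\epsilon}$. $\lambda_r^a=\sum_{s=0}^aP_{r,d-s}$ is the eigenvalue of $\sum_{s=0}^aA_{d-s}$ on $V_r$. Gaussian coefficients are $0$ outside $0\le k\le n$. -}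

module Defs where

open import Data.Nat as ℕ using (ℕ; zero; suc; _+_; _*_; _∸_; _⊔_; _⊓_)
open import Data.Integer as ℤ using (ℤ; +_; -[1+_])
open import Data.List using (List; map; upTo)
open import Data.Product using (Σ; _×_; ∃-syntax)
open import Data.Nat.Primality using (Prime)
open import Relation.Binary.PropositionalEquality using (_≡_)

data PolarType : Set where
  Q⁺odd  : PolarType   -- Q⁺(2d-1,q),  ε = 0
  Hodd   : PolarType   -- H(2d-1,q),   ε = 1/2
  Qpar   : PolarType   -- Q(2d,q),     ε = 1
  Wsymp  : PolarType   -- W(2d-1,q),   ε = 1
  Heven  : PolarType   -- H(2d,q),     ε = 3/2
  Q⁻odd  : PolarType   -- Q⁻(2d+1,q),  ε = 2

twoε : PolarType → ℕ
twoε Q⁺odd = 0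
twoε Hodd  = 1
twoε Qpar  = 2
twoε Wsymp = 2
twoε Heven = 3
twoε Q⁻odd = 4

-- The polar spaces are parametrised by the order f of a finite field:
-- Q⁺,Q,W,Q⁻ live over GF(f) and have order q = f; the Hermitian ones
-- live over GF(f²) and have order q = f².
order : PolarType → ℕ → ℕ
order Hodd  f = f * f
order Heven f = f * f
order _     f = f

IsPrimePower : ℕ → Set
IsPrimePower n = ∃[ p ] ∃[ k ] (Prime p × n ≡ p ℕ.^ suc k)

-- q^{m ε}, computed exactly: for Hermitian types q^{mε} = f^{m·2ε}
-- (since q = f²); otherwise ε is an integer and q^{mε} = f^{m·ε}.
qPowε : PolarType → ℕ → ℕ → ℕ
qPowε Hodd  f m = f ℕ.^ (m * twoε Hodd)
qPowε Heven f m = f ℕ.^ (m * twoε Heven)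
qPowε Q⁺odd f m = f ℕ.^ (m * 0)
qPowε Qpar  f m = f ℕ.^ (m * 1)
qPowε Wsymp f m = f ℕ.^ (m * 1)
qPowε Q⁻odd f m = f ℕ.^ (m * 2)

choose2 : ℕ → ℕ
choose2 zero    = 0
choose2 (suc n) = n + choose2 n

gauss : ℕ → ℕ → ℕ → ℕ
gauss q zero    zero    = 1
gauss q zero    (suc k) = 0
gauss q (suc n) zero    = 1
gauss q (suc n) (suc k) = gauss q n k + q ℕ.^ suc k * gauss q n (suc k)

-- Σ_{t=lo}^{hi} g t  (empty if hi < lo)
sumRange : ℕ → ℕ → (ℕ → ℤ) → ℤ
sumRange lo hi g = Data.List.foldr ℤ._+_ (+ 0) (map (λ i → g (lo + i)) (upTo (suc hi ∸ lo)))

P : PolarType → ℕ → ℕ → ℕ → ℕ → ℤ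
P T f d r s =
  sumRange (r ∸ s) ((d ∸ s) ⊓ r) λ t →
    (-[1+ 0 ] ℤ.^ (r ∸ t)) ℤ.*
    + (gauss q (d ∸ r) (d ∸ s ∸ t) * gauss q r t
        * q ℕ.^ (choose2 (r ∸ t) + choose2 (s + t ∸ r))
        * qPowε T f (s + t ∸ r))
  where q = order T f

eigλ : PolarType → ℕ → ℕ → ℕ → ℕ → ℤ
eigλ T f d a r = sumRange 0 a λ s → P T f d r (d ∸ s)

-- For r ∈ {1, d−1, d} and s ≥ 2 the sum defining P_{r,s} has at most two terms, and the partial
-- sums λ_r^a telescope by the two Pascal rules for Gaussian coefficients,
--   [n+1, k] = [n, k−1] + q^k [n, k]   and   [n+1, k] = [n, k] + q^{n+1−k} [n, k−1].
-- Writing d = a + m + 2 and W = [d−1, a] q^{binom(m+1,2)} this gives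
--   λ_d^a = ± W q^{m+1},   λ_1^a = − W q^{(m+1)ε},
--   λ_{d−1}^a = ± ([d−2, a−1] q^{binom(m+2,2)} − [d−2, a] q^{binom(m+1,2)} q^ε).
-- Part (a) is the comparison of q^{m+1} with q^{(m+1)ε}.  For (b), expand [d−1, a] in |λ_1^a|
-- by the second rule and in |λ_d^a| by the first, and use q^ε ≤ q^{(m+1)ε}, respectively
-- q^ε ≤ q² ≤ q^{a+m+1}; the last step is where d ≥ 3 is needed.
module Submission where

open import Defs
open import Data.Nat using (ℕ; _+_; _∸_; _≤_; _<_)
open import Data.Integer using (∣_∣)
open import Data.Product using (_×_)
open import Relation.Binary.PropositionalEquality using (_≡_)

open import Data.Nat as ℕ using (zero; suc; _*_; _^_; _⊓_; z≤n; s≤s)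
import Data.Nat.Properties as ℕₚ
open import Data.Nat.Tactic.RingSolver as ℕ-Solver using ()
open import Data.Integer as ℤ using (ℤ; +_; -[1+_]; -_)
import Data.Integer.Properties as ℤₚ
open import Data.Integer.Tactic.RingSolver as ℤ-Solver using ()
open import Data.List using (map; applyUpTo; foldr)
open import Data.Product using (_,_; ∃-syntax)
open import Function using (_∘_)
open import Algebra.Properties.CommutativeSemigroup ℤₚ.+-commutativeSemigroup using () renaming (interchange to ℤ-interchange)
open import Relation.Binary.PropositionalEquality using (refl; sym; trans; cong; cong₂; subst; subst₂; module ≡-Reasoning)

foldr-+-map-applyUpTo-suc : ∀ (g : ℕ → ℤ) h n →
  foldr ℤ._+_ (+ 0) (map g (applyUpTo h (suc n))) ≡ foldr ℤ._+_ (+ 0) (map g (applyUpTo h n)) ℤ.+ g (h n)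
foldr-+-map-applyUpTo-suc g h zero = ℤₚ.+-comm (g (h 0)) (+ 0)
foldr-+-map-applyUpTo-suc g h (suc n) =
  trans (cong (ℤ._+_ (g (h 0))) (foldr-+-map-applyUpTo-suc g (h ∘ suc) n)) (sym (ℤₚ.+-assoc (g (h 0)) _ _))

sumRange-singleton : ∀ j g → sumRange j j g ≡ g j
sumRange-singleton j g rewrite ℕₚ.m+n∸n≡m 1 j | ℕₚ.+-identityʳ j = ℤₚ.+-identityʳ (g j)

sumRange-pair : ∀ j g → sumRange j (suc j) g ≡ g j ℤ.+ g (suc j)
sumRange-pair j g rewrite ℕₚ.m+n∸n≡m 2 j | ℕₚ.+-identityʳ j | ℕₚ.+-comm j 1 =
  cong (ℤ._+_ (g j)) (ℤₚ.+-identityʳ (g (suc j)))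

-- Gaussian binomial coefficients

module _ (q : ℕ) where

  gaussPred : ℕ → ℕ → ℕ
  gaussPred n zero    = 0
  gaussPred n (suc k) = gauss q n k

  gauss[n,0]≡1 : ∀ n → gauss q n 0 ≡ 1
  gauss[n,0]≡1 zero    = refl
  gauss[n,0]≡1 (suc n) = refl

  n<k⇒gauss[n,k]≡0 : ∀ {n k} → n < k → gauss q n k ≡ 0
  n<k⇒gauss[n,k]≡0 {zero}  {suc k} _ = refl
  n<k⇒gauss[n,k]≡0 {suc n} {suc k} (s≤s n<k)
    rewrite n<k⇒gauss[n,k]≡0 n<k | n<k⇒gauss[n,k]≡0 (ℕₚ.m<n⇒m<1+n n<k) = ℕₚ.*-zeroʳ (q ^ suc k)

  gauss[n,n]≡1 : ∀ n → gauss q n n ≡ 1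
  gauss[n,n]≡1 zero = refl
  gauss[n,n]≡1 (suc n)
    rewrite gauss[n,n]≡1 n | n<k⇒gauss[n,k]≡0 (ℕₚ.n<1+n n) = cong suc (ℕₚ.*-zeroʳ (q ^ suc n))

  gauss-pos : ∀ {n k} → k ≤ n → 1 ≤ gauss q n k
  gauss-pos {n} {zero}  _         = ℕₚ.≤-reflexive (sym (gauss[n,0]≡1 n))
  gauss-pos {suc n} {suc k} (s≤s k≤n) = ℕₚ.≤-trans (gauss-pos k≤n) (ℕₚ.m≤m+n _ _)

  gauss-pascal : ∀ n k → gauss q (suc n) k ≡ gaussPred n k + q ^ k * gauss q n k
  gauss-pascal n zero    = cong (q ^ 0 *_) (sym (gauss[n,0]≡1 n))
  gauss-pascal n (suc k) = refl

  gauss-pascal′ : ∀ t k → gauss q (suc (t + k)) (suc k) ≡ gauss q (t + k) (suc k) + q ^ t * gauss q (t + k) k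
  gauss-pascal′ zero k
    rewrite gauss[n,n]≡1 (suc k) | gauss[n,n]≡1 k | n<k⇒gauss[n,k]≡0 (ℕₚ.n<1+n k) = refl
  gauss-pascal′ (suc t) zero = begin
    1 + q ^ 1 * gauss q (suc (t + 0)) 1
      ≡⟨ cong (λ x → 1 + q ^ 1 * x) (gauss-pascal′ t zero) ⟩
    1 + q ^ 1 * (gauss q (t + 0) 1 + q ^ t * gauss q (t + 0) 0)
      ≡⟨ cong (λ x → 1 + q ^ 1 * (gauss q (t + 0) 1 + q ^ t * x)) (gauss[n,0]≡1 (t + 0)) ⟩
    1 + q ^ 1 * (gauss q (t + 0) 1 + q ^ t * 1)
      ≡⟨ regroup q (gauss q (t + 0) 1) (q ^ t) ⟩
    (1 + q ^ 1 * gauss q (t + 0) 1) + q * q ^ t * 1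
      ≡⟨ cong (λ x → (x + q ^ 1 * gauss q (t + 0) 1) + q * q ^ t * 1) (sym (gauss[n,0]≡1 (t + 0))) ⟩
    gauss q (suc (t + 0)) 1 + q ^ suc t * gauss q (suc (t + 0)) 0 ∎
    where
    open ≡-Reasoning
    regroup : ∀ p x y → 1 + p * 1 * (x + y * 1) ≡ (1 + p * 1 * x) + p * y * 1
    regroup = ℕ-Solver.solve-∀
  gauss-pascal′ (suc t) (suc k) rewrite ℕₚ.+-suc t k = begin
    gauss q (suc N) (suc k) + q ^ suc (suc k) * gauss q (suc N) (suc (suc k))
      ≡⟨ cong₂ (λ x y → x + q ^ suc (suc k) * y) ih₁ ih₂ ⟩
    (gauss q N (suc k) + q ^ suc t * gauss q N k)
      + q ^ suc (suc k) * (gauss q N (suc (suc k)) + q ^ t * gauss q N (suc k))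
      ≡⟨ regroup q (q ^ t) (q ^ k) (gauss q N k) (gauss q N (suc k)) (gauss q N (suc (suc k))) ⟩
    (gauss q N (suc k) + q ^ suc (suc k) * gauss q N (suc (suc k)))
      + q ^ suc t * (gauss q N k + q ^ suc k * gauss q N (suc k)) ∎
    where
    open ≡-Reasoning
    N = suc (t + k)
    ih₁ : gauss q (suc N) (suc k) ≡ gauss q N (suc k) + q ^ suc t * gauss q N k
    ih₁ = gauss-pascal′ (suc t) k
    ih₂ : gauss q (suc N) (suc (suc k)) ≡ gauss q N (suc (suc k)) + q ^ t * gauss q N (suc k)
    ih₂ = subst (λ n → gauss q (suc n) (suc (suc k)) ≡ gauss q n (suc (suc k)) + q ^ t * gauss q n (suc k))
                (ℕₚ.+-suc t k) (gauss-pascal′ t (suc k))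
    regroup : ∀ p x y A B C →
      (B + p * x * A) + p * (p * y) * (C + x * B) ≡ (B + p * (p * y) * C) + p * x * (A + p * y * B)
    regroup = ℕ-Solver.solve-∀

  gauss-pascal′-pred : ∀ t k → gauss q (suc (t + k)) k ≡ gauss q (t + k) k + q ^ suc t * gaussPred (t + k) k
  gauss-pascal′-pred t zero
    rewrite gauss[n,0]≡1 (t + 0) | ℕₚ.*-zeroʳ (q ^ suc t) = refl
  gauss-pascal′-pred t (suc k) =
    subst (λ n → gauss q (suc n) (suc k) ≡ gauss q n (suc k) + q ^ suc t * gauss q n k)
          (sym (ℕₚ.+-suc t k)) (gauss-pascal′ (suc t) k)

-- q = f ^ fieldDegree T and q^{kε} = f ^ (k * εDegree T).
fieldDegree : PolarType → ℕ
fieldDegree Hodd  = 2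
fieldDegree Heven = 2
fieldDegree _     = 1

εDegree : PolarType → ℕ
εDegree Q⁺odd = 0
εDegree Hodd  = 1
εDegree Qpar  = 1
εDegree Wsymp = 1
εDegree Heven = 3
εDegree Q⁻odd = 2

order≡f^fieldDegree : ∀ T f → order T f ≡ f ^ fieldDegree T
order≡f^fieldDegree Q⁺odd f = sym (ℕₚ.*-identityʳ f)
order≡f^fieldDegree Hodd  f = cong (f *_) (sym (ℕₚ.*-identityʳ f))
order≡f^fieldDegree Qpar  f = sym (ℕₚ.*-identityʳ f)
order≡f^fieldDegree Wsymp f = sym (ℕₚ.*-identityʳ f)
order≡f^fieldDegree Heven f = cong (f *_) (sym (ℕₚ.*-identityʳ f))
order≡f^fieldDegree Q⁻odd f = sym (ℕₚ.*-identityʳ f)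

qPowε≡f^εDegree : ∀ T f k → qPowε T f k ≡ f ^ (k * εDegree T)
qPowε≡f^εDegree Q⁺odd f k = refl
qPowε≡f^εDegree Hodd  f k = refl
qPowε≡f^εDegree Qpar  f k = refl
qPowε≡f^εDegree Wsymp f k = refl
qPowε≡f^εDegree Heven f k = refl
qPowε≡f^εDegree Q⁻odd f k = refl

order^≡f^ : ∀ T f k → order T f ^ k ≡ f ^ (fieldDegree T * k)
order^≡f^ T f k = trans (cong (_^ k) (order≡f^fieldDegree T f)) (ℕₚ.^-*-assoc f (fieldDegree T) k)

2<twoε⇒fieldDegree<εDegree : ∀ T → 2 < twoε T → fieldDegree T < εDegree T
2<twoε⇒fieldDegree<εDegree Heven _ = ℕₚ.≤-refl
2<twoε⇒fieldDegree<εDegree Q⁻odd _ = ℕₚ.≤-refl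
2<twoε⇒fieldDegree<εDegree Q⁺odd ()
2<twoε⇒fieldDegree<εDegree Hodd  (s≤s ())
2<twoε⇒fieldDegree<εDegree Qpar  (s≤s (s≤s ()))
2<twoε⇒fieldDegree<εDegree Wsymp (s≤s (s≤s ()))

twoε≡2⇒εDegree≡fieldDegree : ∀ T → twoε T ≡ 2 → εDegree T ≡ fieldDegree T
twoε≡2⇒εDegree≡fieldDegree Qpar  _ = refl
twoε≡2⇒εDegree≡fieldDegree Wsymp _ = refl
twoε≡2⇒εDegree≡fieldDegree Q⁺odd ()
twoε≡2⇒εDegree≡fieldDegree Hodd  ()
twoε≡2⇒εDegree≡fieldDegree Heven ()
twoε≡2⇒εDegree≡fieldDegree Q⁻odd ()

twoε<2⇒εDegree<fieldDegree : ∀ T → twoε T < 2 → εDegree T < fieldDegree T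
twoε<2⇒εDegree<fieldDegree Q⁺odd _ = ℕₚ.≤-refl
twoε<2⇒εDegree<fieldDegree Hodd  _ = ℕₚ.≤-refl
twoε<2⇒εDegree<fieldDegree Qpar  (s≤s (s≤s ()))
twoε<2⇒εDegree<fieldDegree Wsymp (s≤s (s≤s ()))
twoε<2⇒εDegree<fieldDegree Heven (s≤s (s≤s ()))
twoε<2⇒εDegree<fieldDegree Q⁻odd (s≤s (s≤s ()))

εDegree≤2*fieldDegree : ∀ T → εDegree T ≤ fieldDegree T * 2
εDegree≤2*fieldDegree Q⁺odd = z≤n
εDegree≤2*fieldDegree Hodd  = s≤s z≤n
εDegree≤2*fieldDegree Qpar  = s≤s z≤n
εDegree≤2*fieldDegree Wsymp = s≤s z≤n
εDegree≤2*fieldDegree Heven = s≤s (s≤s (s≤s z≤n))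
εDegree≤2*fieldDegree Q⁻odd = ℕₚ.≤-refl

3≤order⇒2≤f : ∀ T f → 3 ≤ order T f → 2 ≤ f
3≤order⇒2≤f T f 3≤q = ℕₚ.≰⇒> λ f≤1 → ℕₚ.<⇒≱ 3≤q (begin
  order T f          ≡⟨ order≡f^fieldDegree T f ⟩
  f ^ fieldDegree T  ≤⟨ ℕₚ.^-monoˡ-≤ (fieldDegree T) f≤1 ⟩
  1 ^ fieldDegree T  ≡⟨ ℕₚ.^-zeroˡ (fieldDegree T) ⟩
  1                  ≤⟨ ℕₚ.n≤1+n 1 ⟩
  2                  ∎)
  where open ℕₚ.≤-Reasoning

-- Closed forms of λ_d^a, λ_1^a and λ_{d−1}^a

sign : ℕ → ℤ
sign n = -[1+ 0 ] ℤ.^ n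

∣sign∣≡1 : ∀ n → ∣ sign n ∣ ≡ 1
∣sign∣≡1 zero    = refl
∣sign∣≡1 (suc n) = trans (ℤₚ.abs-* -[1+ 0 ] (sign n)) (trans (ℕₚ.+-identityʳ _) (∣sign∣≡1 n))

∣sign*+∣ : ∀ n x → ∣ sign n ℤ.* + x ∣ ≡ x
∣sign*+∣ n x = trans (ℤₚ.abs-* (sign n) (+ x)) (trans (cong (_* x) (∣sign∣≡1 n)) (ℕₚ.*-identityˡ x))

sign-suc-cancel : ∀ k x y → sign (suc k) ℤ.* + x ℤ.+ sign k ℤ.* + (y + x) ≡ sign k ℤ.* + y
sign-suc-cancel k x y rewrite ℤₚ.pos-+ y x = lemma (sign k) (+ x) (+ y)
  where
  lemma : ∀ s X Y → (-[1+ 0 ] ℤ.* s) ℤ.* X ℤ.+ s ℤ.* (Y ℤ.+ X) ≡ s ℤ.* Y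
  lemma = ℤ-Solver.solve-∀

module _ (T : PolarType) (f : ℕ) where

  private
    q : ℕ
    q = order T f

    g : ℕ → ℕ
    g = qPowε T f

  eigλ-zero : ∀ d r → eigλ T f d 0 r ≡ P T f d r d
  eigλ-zero d r = ℤₚ.+-identityʳ (P T f d r d)

  eigλ-suc : ∀ d a r → eigλ T f d (suc a) r ≡ eigλ T f d a r ℤ.+ P T f d r (d ∸ suc a)
  eigλ-suc d a r = foldr-+-map-applyUpTo-suc (λ s → P T f d r (d ∸ s)) (λ i → i) (suc a)

  eigλ-telescope : (r : ℕ → ℕ) (C : ℕ → ℕ → ℤ) →
    (∀ u → P T f (2 + u + 0) (r (2 + u + 0)) (2 + u) ≡ C u 0) →
    (∀ u a → C (suc u) a ℤ.+ P T f (2 + u + suc a) (r (2 + u + suc a)) (2 + u) ≡ C u (suc a)) →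
    ∀ u a → eigλ T f (2 + u + a) a (r (2 + u + a)) ≡ C u a
  eigλ-telescope r C base step u zero =
    trans (eigλ-zero (2 + u + 0) (r (2 + u + 0)))
          (trans (cong (P T f (2 + u + 0) (r (2 + u + 0))) (ℕₚ.+-identityʳ (2 + u))) (base u))
  eigλ-telescope r C base step u (suc a) = begin
    eigλ T f d (suc a) (r d)                         ≡⟨ eigλ-suc d a (r d) ⟩
    eigλ T f d a (r d) ℤ.+ P T f d (r d) (d ∸ suc a) ≡⟨ cong₂ ℤ._+_ ih (cong (P T f d (r d)) (ℕₚ.m+n∸n≡m (2 + u) (suc a))) ⟩
    C (suc u) a ℤ.+ P T f d (r d) (2 + u)            ≡⟨ step u a ⟩
    C u (suc a)                                      ∎
    where
    open ≡-Reasoning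
    d = 2 + u + suc a
    ih : eigλ T f d a (r d) ≡ C (suc u) a
    ih = subst (λ n → eigλ T f n a (r n) ≡ C (suc u) a)
               (cong (λ n → 2 + n) (sym (ℕₚ.+-suc u a))) (eigλ-telescope r C base step (suc u) a)

  private
    P-summand : ℕ → ℕ → ℕ → ℕ → ℤ
    P-summand d r s t = sign (r ∸ t) ℤ.* + (gauss q (d ∸ r) (d ∸ s ∸ t) * gauss q r t
      * q ^ (choose2 (r ∸ t) + choose2 (s + t ∸ r)) * g (s + t ∸ r))

    P-summand-at : ∀ d r s t {e x y c} → r ∸ t ≡ e → d ∸ r ≡ x → d ∸ s ∸ t ≡ y → s + t ∸ r ≡ c →
      P-summand d r s t ≡ sign e ℤ.* + (gauss q x y * gauss q r t * q ^ (choose2 e + choose2 c) * g c)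
    P-summand-at d r s t refl refl refl refl = refl

    g0≡1 : g 0 ≡ 1
    g0≡1 = qPowε≡f^εDegree T f 0

    unit-left : ∀ {x} G k Y → x ≡ 1 → x * G * q ^ (k + 0) * Y ≡ G * (q ^ k * Y)
    unit-left G k Y refl rewrite ℕₚ.+-identityʳ k = lemma G (q ^ k) Y
      where
      lemma : ∀ G Q Y → 1 * G * Q * Y ≡ G * (Q * Y)
      lemma = ℕ-Solver.solve-∀

    unit-left-g0 : ∀ {x} G k → x ≡ 1 → x * G * q ^ (k + 0) * g 0 ≡ G * q ^ k
    unit-left-g0 G k x≡1 rewrite unit-left G k (g 0) x≡1 | g0≡1 = cong (G *_) (ℕₚ.*-identityʳ (q ^ k))

    unit-middle : ∀ {x} G Q Y → x ≡ 1 → G * x * Q * Y ≡ G * (Q * Y)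
    unit-middle G Q Y refl = lemma G Q Y
      where
      lemma : ∀ G Q Y → G * 1 * Q * Y ≡ G * (Q * Y)
      lemma = ℕ-Solver.solve-∀

  P-d : ∀ s j → P T f (s + j) (s + j) s ≡ sign s ℤ.* + (gauss q (s + j) j * q ^ choose2 s)
  P-d s j = begin
    sumRange (d ∸ s) ((d ∸ s) ⊓ d) (P-summand d d s)
      ≡⟨ cong₂ (λ lo hi → sumRange lo hi (P-summand d d s)) d∸s≡j
               (trans (cong (_⊓ d) d∸s≡j) (ℕₚ.m≤n⇒m⊓n≡m (ℕₚ.m≤n+m j s))) ⟩
    sumRange j j (P-summand d d s)
      ≡⟨ sumRange-singleton j (P-summand d d s) ⟩
    P-summand d d s j
      ≡⟨ P-summand-at d d s j (ℕₚ.m+n∸n≡m s j) (ℕₚ.n∸n≡0 d) (trans (cong (_∸ j) d∸s≡j) (ℕₚ.n∸n≡0 j)) (ℕₚ.n∸n≡0 d) ⟩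
    sign s ℤ.* + (gauss q 0 0 * gauss q d j * q ^ (choose2 s + choose2 0) * g 0)
      ≡⟨ cong (λ n → sign s ℤ.* + n) (unit-left-g0 (gauss q d j) (choose2 s) refl) ⟩
    sign s ℤ.* + (gauss q d j * q ^ choose2 s) ∎
    where
    open ≡-Reasoning
    d = s + j
    d∸s≡j : d ∸ s ≡ j
    d∸s≡j = ℕₚ.m+n∸m≡n s j

  P-1 : ∀ u j → P T f (2 + u + j) 1 (2 + u) ≡
    - + (gauss q (suc (u + j)) j * (q ^ choose2 (suc u) * g (suc u)))
      ℤ.+ + (gaussPred q (suc (u + j)) j * (q ^ choose2 (2 + u) * g (2 + u)))
  P-1 u zero = begin
    sumRange 0 ((u + 0 ∸ u) ⊓ 1) (P-summand d 1 s)
      ≡⟨ cong (λ hi → sumRange 0 (hi ⊓ 1) (P-summand d 1 s)) (ℕₚ.m+n∸m≡n u 0) ⟩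
    sumRange 0 0 (P-summand d 1 s)
      ≡⟨ sumRange-singleton 0 (P-summand d 1 s) ⟩
    P-summand d 1 s 0
      ≡⟨ P-summand-at d 1 s 0 refl refl (ℕₚ.m+n∸m≡n u 0) (cong suc (ℕₚ.+-identityʳ u)) ⟩
    sign 1 ℤ.* + (1 * 1 * q ^ choose2 (suc u) * g (suc u))
      ≡⟨ ℤₚ.-1*i≡-i _ ⟩
    - + (1 * 1 * q ^ choose2 (suc u) * g (suc u))
      ≡⟨ cong (λ n → - + n) (unit-middle 1 (q ^ choose2 (suc u)) (g (suc u)) refl) ⟩
    - + (1 * (q ^ choose2 (suc u) * g (suc u)))
      ≡⟨ ℤₚ.+-identityʳ _ ⟨
    - + (1 * (q ^ choose2 (suc u) * g (suc u))) ℤ.+ + 0 ∎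
    where
    open ≡-Reasoning
    s = 2 + u
    d = 2 + u + 0
  P-1 u (suc i) = begin
    sumRange 0 ((u + suc i ∸ u) ⊓ 1) (P-summand d 1 s)
      ≡⟨ cong (λ hi → sumRange 0 (hi ⊓ 1) (P-summand d 1 s)) (ℕₚ.m+n∸m≡n u (suc i)) ⟩
    sumRange 0 (suc (i ⊓ 0)) (P-summand d 1 s)
      ≡⟨ cong (λ hi → sumRange 0 (suc hi) (P-summand d 1 s)) (ℕₚ.⊓-zeroʳ i) ⟩
    sumRange 0 1 (P-summand d 1 s)
      ≡⟨ sumRange-pair 0 (P-summand d 1 s) ⟩
    P-summand d 1 s 0 ℤ.+ P-summand d 1 s 1
      ≡⟨ cong₂ ℤ._+_ (P-summand-at d 1 s 0 refl refl (ℕₚ.m+n∸m≡n u (suc i)) (cong suc (ℕₚ.+-identityʳ u)))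
                     (P-summand-at d 1 s 1 refl refl (cong (_∸ 1) (ℕₚ.m+n∸m≡n u (suc i))) (cong suc (ℕₚ.+-comm u 1))) ⟩
    sign 1 ℤ.* + (gauss q N (suc i) * 1 * Q₁ * g (suc u))
      ℤ.+ sign 0 ℤ.* + (gauss q N i * gauss q 1 1 * Q₂ * g (2 + u))
      ≡⟨ cong₂ ℤ._+_ (ℤₚ.-1*i≡-i (+ (gauss q N (suc i) * 1 * Q₁ * g (suc u))))
                     (ℤₚ.*-identityˡ (+ (gauss q N i * gauss q 1 1 * Q₂ * g (2 + u)))) ⟩
    - + (gauss q N (suc i) * 1 * Q₁ * g (suc u)) ℤ.+ + (gauss q N i * gauss q 1 1 * Q₂ * g (2 + u))
      ≡⟨ cong₂ (λ m n → - + m ℤ.+ + n) (unit-middle (gauss q N (suc i)) Q₁ (g (suc u)) refl)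
                                         (unit-middle (gauss q N i) Q₂ (g (2 + u)) (gauss[n,n]≡1 q 1)) ⟩
    - + (gauss q N (suc i) * (Q₁ * g (suc u))) ℤ.+ + (gauss q N i * (Q₂ * g (2 + u))) ∎
    where
    open ≡-Reasoning
    s = 2 + u
    d = 2 + u + suc i
    N = suc (u + suc i)
    Q₁ = q ^ choose2 (suc u)
    Q₂ = q ^ choose2 (2 + u)

  P-d∸1 : ∀ u j → P T f (2 + u + j) (suc (u + j)) (2 + u) ≡
    sign (2 + u) ℤ.* + (gaussPred q (suc (u + j)) j * q ^ choose2 (2 + u))
      ℤ.+ sign (suc u) ℤ.* + (gauss q (suc (u + j)) j * (q ^ choose2 (suc u) * g 1))
  P-d∸1 u zero = begin
    sumRange (u + 0 ∸ suc u) ((u + 0 ∸ u) ⊓ r) (P-summand d r s)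
      ≡⟨ cong₂ (λ lo hi → sumRange lo (hi ⊓ r) (P-summand d r s)) lo≡0 (ℕₚ.m+n∸m≡n u 0) ⟩
    sumRange 0 0 (P-summand d r s)
      ≡⟨ sumRange-singleton 0 (P-summand d r s) ⟩
    P-summand d r s 0
      ≡⟨ P-summand-at d r s 0 (cong suc (ℕₚ.+-identityʳ u)) (ℕₚ.m+n∸n≡m 1 (u + 0)) (ℕₚ.m+n∸m≡n u 0) (ℕₚ.m+n∸n≡m 1 (u + 0)) ⟩
    sign (suc u) ℤ.* + (1 * 1 * q ^ (choose2 (suc u) + 0) * g 1)
      ≡⟨ cong (λ n → sign (suc u) ℤ.* + n) (unit-left 1 (choose2 (suc u)) (g 1) refl) ⟩
    sign (suc u) ℤ.* + (1 * (q ^ choose2 (suc u) * g 1))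
      ≡⟨ ℤₚ.+-identityˡ _ ⟨
    + 0 ℤ.+ sign (suc u) ℤ.* + (1 * (q ^ choose2 (suc u) * g 1))
      ≡⟨ cong (ℤ._+ sign (suc u) ℤ.* + (1 * (q ^ choose2 (suc u) * g 1))) (ℤₚ.*-zeroʳ (sign (2 + u))) ⟨
    sign (2 + u) ℤ.* + 0 ℤ.+ sign (suc u) ℤ.* + (1 * (q ^ choose2 (suc u) * g 1)) ∎
    where
    open ≡-Reasoning
    s = 2 + u
    d = 2 + u + 0
    r = suc (u + 0)
    lo≡0 : u + 0 ∸ suc u ≡ 0
    lo≡0 = ℕₚ.m≤n⇒m∸n≡0 (ℕₚ.≤-trans (ℕₚ.≤-reflexive (ℕₚ.+-identityʳ u)) (ℕₚ.n≤1+n u))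
  P-d∸1 u (suc i) = begin
    sumRange (u + suc i ∸ suc u) ((u + suc i ∸ u) ⊓ N) (P-summand d N s)
      ≡⟨ cong₂ (λ lo hi → sumRange lo hi (P-summand d N s)) lo≡i hi≡1+i ⟩
    sumRange i (suc i) (P-summand d N s)
      ≡⟨ sumRange-pair i (P-summand d N s) ⟩
    P-summand d N s i ℤ.+ P-summand d N s (suc i)
      ≡⟨ cong₂ ℤ._+_
           (P-summand-at d N s i
             (trans (cong (λ n → suc n ∸ i) (ℕₚ.+-suc u i)) (ℕₚ.m+n∸n≡m (2 + u) i))
             (ℕₚ.m+n∸n≡m 1 N)
             (trans (cong (_∸ i) (ℕₚ.m+n∸m≡n u (suc i))) (ℕₚ.m+n∸n≡m 1 i))
             (trans (cong (suc (u + i) ∸_) (ℕₚ.+-suc u i)) (ℕₚ.n∸n≡0 (suc (u + i)))))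
           (P-summand-at d N s (suc i)
             (trans (cong (_∸ i) (ℕₚ.+-suc u i)) (ℕₚ.m+n∸n≡m (suc u) i))
             (ℕₚ.m+n∸n≡m 1 N)
             (trans (cong (_∸ suc i) (ℕₚ.m+n∸m≡n u (suc i))) (ℕₚ.n∸n≡0 (suc i)))
             (ℕₚ.m+n∸n≡m 1 N)) ⟩
    sign (2 + u) ℤ.* + (gauss q 1 1 * gauss q N i * q ^ (choose2 (2 + u) + 0) * g 0)
      ℤ.+ sign (suc u) ℤ.* + (1 * gauss q N (suc i) * q ^ (choose2 (suc u) + 0) * g 1)
      ≡⟨ cong₂ (λ m n → sign (2 + u) ℤ.* + m ℤ.+ sign (suc u) ℤ.* + n)
           (unit-left-g0 (gauss q N i) (choose2 (2 + u)) (gauss[n,n]≡1 q 1))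
           (unit-left (gauss q N (suc i)) (choose2 (suc u)) (g 1) refl) ⟩
    sign (2 + u) ℤ.* + (gauss q N i * q ^ choose2 (2 + u))
      ℤ.+ sign (suc u) ℤ.* + (gauss q N (suc i) * (q ^ choose2 (suc u) * g 1)) ∎
    where
    open ≡-Reasoning
    s = 2 + u
    d = 2 + u + suc i
    N = suc (u + suc i)
    lo≡i : u + suc i ∸ suc u ≡ i
    lo≡i = trans (cong (_∸ suc u) (ℕₚ.+-suc u i)) (ℕₚ.m+n∸m≡n u i)
    hi≡1+i : (u + suc i ∸ u) ⊓ N ≡ suc i
    hi≡1+i = trans (cong (_⊓ N) (ℕₚ.m+n∸m≡n u (suc i)))
                   (ℕₚ.m≤n⇒m⊓n≡m (s≤s (ℕₚ.≤-trans (ℕₚ.n≤1+n i) (ℕₚ.m≤n+m (suc i) u))))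

  private
    q^choose2-suc : ∀ n → q ^ choose2 (suc n) ≡ q ^ n * q ^ choose2 n
    q^choose2-suc n = ℕₚ.^-distribˡ-+-* q n (choose2 n)

    weighted-split : ∀ {G G₀ G₁} x Q → G ≡ G₀ + x * G₁ → G * Q ≡ G₀ * Q + G₁ * (x * Q)
    weighted-split {G₀ = G₀} {G₁} x Q refl = lemma G₀ G₁ x Q
      where
      lemma : ∀ G₀ G₁ x Q → (G₀ + x * G₁) * Q ≡ G₀ * Q + G₁ * (x * Q)
      lemma = ℕ-Solver.solve-∀

  eigλ-d : ∀ u a → eigλ T f (2 + u + a) a (2 + u + a) ≡ sign (2 + u) ℤ.* + (gauss q (suc (u + a)) a * q ^ choose2 (2 + u))
  eigλ-d = eigλ-telescope (λ d → d) C (λ u → P-d (2 + u) 0) step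
    where
    C : ℕ → ℕ → ℤ
    C u a = sign (2 + u) ℤ.* + (gauss q (suc (u + a)) a * q ^ choose2 (2 + u))
    step : ∀ u a → C (suc u) a ℤ.+ P T f (2 + u + suc a) (2 + u + suc a) (2 + u) ≡ C u (suc a)
    step u a rewrite P-d (2 + u) (suc a) | ℕₚ.+-suc u a = begin
      sign (3 + u) ℤ.* + (gauss q M a * Q₃) ℤ.+ sign (2 + u) ℤ.* + (gauss q (suc M) (suc a) * Q₂)
        ≡⟨ cong (λ n → sign (3 + u) ℤ.* + (gauss q M a * Q₃) ℤ.+ sign (2 + u) ℤ.* + n) split ⟩
      sign (3 + u) ℤ.* + (gauss q M a * Q₃) ℤ.+ sign (2 + u) ℤ.* + (gauss q M (suc a) * Q₂ + gauss q M a * Q₃)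
        ≡⟨ sign-suc-cancel (2 + u) (gauss q M a * Q₃) (gauss q M (suc a) * Q₂) ⟩
      sign (2 + u) ℤ.* + (gauss q M (suc a) * Q₂) ∎
      where
      open ≡-Reasoning
      M = 2 + u + a
      Q₂ = q ^ choose2 (2 + u)
      Q₃ = q ^ choose2 (3 + u)
      split : gauss q (suc M) (suc a) * Q₂ ≡ gauss q M (suc a) * Q₂ + gauss q M a * Q₃
      split = trans (weighted-split (q ^ (2 + u)) Q₂ (gauss-pascal′ q (2 + u) a))
                    (cong (λ n → gauss q M (suc a) * Q₂ + gauss q M a * n) (sym (q^choose2-suc (2 + u))))

  eigλ-1 : ∀ u a → eigλ T f (2 + u + a) a 1 ≡ - + (gauss q (suc (u + a)) a * (q ^ choose2 (suc u) * g (suc u)))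
  eigλ-1 = eigλ-telescope (λ _ → 1) C (λ u → trans (P-1 u 0) (ℤₚ.+-identityʳ (C u 0))) step
    where
    C : ℕ → ℕ → ℤ
    C u a = - + (gauss q (suc (u + a)) a * (q ^ choose2 (suc u) * g (suc u)))
    step : ∀ u a → C (suc u) a ℤ.+ P T f (2 + u + suc a) 1 (2 + u) ≡ C u (suc a)
    step u a rewrite P-1 u (suc a) | ℕₚ.+-suc u a =
      lemma (+ (gauss q (2 + u + a) a * (q ^ choose2 (2 + u) * g (2 + u))))
            (+ (gauss q (2 + u + a) (suc a) * (q ^ choose2 (suc u) * g (suc u))))
      where
      lemma : ∀ X Y → - X ℤ.+ (- Y ℤ.+ X) ≡ - Y
      lemma = ℤ-Solver.solve-∀

  eigλ-d∸1 : ∀ u a → eigλ T f (2 + u + a) a (suc (u + a)) ≡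
    sign (2 + u) ℤ.* + (gaussPred q (u + a) a * q ^ choose2 (2 + u))
      ℤ.+ sign (suc u) ℤ.* + (gauss q (u + a) a * (q ^ choose2 (suc u) * g 1))
  eigλ-d∸1 = eigλ-telescope (λ d → d ∸ 1) C base step
    where
    C : ℕ → ℕ → ℤ
    C u a = sign (2 + u) ℤ.* + (gaussPred q (u + a) a * q ^ choose2 (2 + u))
              ℤ.+ sign (suc u) ℤ.* + (gauss q (u + a) a * (q ^ choose2 (suc u) * g 1))
    base : ∀ u → P T f (2 + u + 0) (suc (u + 0)) (2 + u) ≡ C u 0
    base u = trans (P-d∸1 u 0)
      (cong (λ n → sign (2 + u) ℤ.* + 0 ℤ.+ sign (suc u) ℤ.* + (n * (q ^ choose2 (suc u) * g 1)))
            (sym (gauss[n,0]≡1 q (u + 0))))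
    step : ∀ u a → C (suc u) a ℤ.+ P T f (2 + u + suc a) (suc (u + suc a)) (2 + u) ≡ C u (suc a)
    step u a rewrite P-d∸1 u (suc a) | ℕₚ.+-suc u a = begin
      (x₃ ℤ.+ y₂) ℤ.+ (s₂ ℤ.* + (gauss q (suc M) a * Q₂) ℤ.+ s₁ ℤ.* + (gauss q (suc M) (suc a) * (Q₁ * g 1)))
        ≡⟨ ℤ-interchange x₃ y₂ (s₂ ℤ.* + (gauss q (suc M) a * Q₂)) (s₁ ℤ.* + (gauss q (suc M) (suc a) * (Q₁ * g 1))) ⟩
      (x₃ ℤ.+ s₂ ℤ.* + (gauss q (suc M) a * Q₂)) ℤ.+ (y₂ ℤ.+ s₁ ℤ.* + (gauss q (suc M) (suc a) * (Q₁ * g 1)))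
        ≡⟨ cong₂ (λ m n → (x₃ ℤ.+ s₂ ℤ.* + m) ℤ.+ (y₂ ℤ.+ s₁ ℤ.* + n)) split₂ split₁ ⟩
      (x₃ ℤ.+ s₂ ℤ.* + (gauss q M a * Q₂ + gaussPred q M a * Q₃))
        ℤ.+ (y₂ ℤ.+ s₁ ℤ.* + (gauss q M (suc a) * (Q₁ * g 1) + gauss q M a * (Q₂ * g 1)))
        ≡⟨ cong₂ ℤ._+_ (sign-suc-cancel (2 + u) (gaussPred q M a * Q₃) (gauss q M a * Q₂))
                       (sign-suc-cancel (suc u) (gauss q M a * (Q₂ * g 1)) (gauss q M (suc a) * (Q₁ * g 1))) ⟩
      s₂ ℤ.* + (gauss q M a * Q₂) ℤ.+ s₁ ℤ.* + (gauss q M (suc a) * (Q₁ * g 1)) ∎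
      where
      open ≡-Reasoning
      M = suc (u + a)
      s₁ = sign (suc u)
      s₂ = sign (2 + u)
      s₃ = sign (3 + u)
      Q₁ = q ^ choose2 (suc u)
      Q₂ = q ^ choose2 (2 + u)
      Q₃ = q ^ choose2 (3 + u)
      x₃ = s₃ ℤ.* + (gaussPred q M a * Q₃)
      y₂ = s₂ ℤ.* + (gauss q M a * (Q₂ * g 1))
      split₂ : gauss q (suc M) a * Q₂ ≡ gauss q M a * Q₂ + gaussPred q M a * Q₃
      split₂ = trans (weighted-split (q ^ (2 + u)) Q₂ (gauss-pascal′-pred q (suc u) a))
                     (cong (λ n → gauss q M a * Q₂ + gaussPred q M a * n) (sym (q^choose2-suc (2 + u))))
      split₁ : gauss q (suc M) (suc a) * (Q₁ * g 1) ≡ gauss q M (suc a) * (Q₁ * g 1) + gauss q M a * (Q₂ * g 1)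
      split₁ = trans (weighted-split (q ^ suc u) (Q₁ * g 1) (gauss-pascal′ q (suc u) a))
                     (cong (λ n → gauss q M (suc a) * (Q₁ * g 1) + gauss q M a * n)
                           (trans (sym (ℕₚ.*-assoc (q ^ suc u) Q₁ (g 1))) (cong (_* g 1) (sym (q^choose2-suc (suc u))))))

  ∣eigλ-d∣ : ∀ u a → ∣ eigλ T f (2 + u + a) a (2 + u + a) ∣ ≡ gauss q (suc (u + a)) a * q ^ choose2 (suc u) * q ^ suc u
  ∣eigλ-d∣ u a = begin
    ∣ eigλ T f (2 + u + a) a (2 + u + a) ∣      ≡⟨ cong ∣_∣ (eigλ-d u a) ⟩
    ∣ sign (2 + u) ℤ.* + (G * q ^ choose2 (2 + u)) ∣ ≡⟨ ∣sign*+∣ (2 + u) _ ⟩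
    G * q ^ choose2 (2 + u)                      ≡⟨ cong (G *_) (q^choose2-suc (suc u)) ⟩
    G * (q ^ suc u * q ^ choose2 (suc u))        ≡⟨ lemma G (q ^ suc u) (q ^ choose2 (suc u)) ⟩
    G * q ^ choose2 (suc u) * q ^ suc u          ∎
    where
    open ≡-Reasoning
    G = gauss q (suc (u + a)) a
    lemma : ∀ G x Q → G * (x * Q) ≡ G * Q * x
    lemma = ℕ-Solver.solve-∀

  ∣eigλ-1∣ : ∀ u a → ∣ eigλ T f (2 + u + a) a 1 ∣ ≡ gauss q (suc (u + a)) a * q ^ choose2 (suc u) * g (suc u)
  ∣eigλ-1∣ u a = trans (cong ∣_∣ (eigλ-1 u a))
    (trans (ℤₚ.∣-i∣≡∣i∣ (+ _)) (sym (ℕₚ.*-assoc (gauss q (suc (u + a)) a) (q ^ choose2 (suc u)) (g (suc u)))))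

  ∣eigλ-d∸1∣≤ : ∀ u a → ∣ eigλ T f (2 + u + a) a (suc (u + a)) ∣ ≤
    gaussPred q (u + a) a * (q ^ suc u * q ^ choose2 (suc u)) + gauss q (u + a) a * (q ^ choose2 (suc u) * g 1)
  ∣eigλ-d∸1∣≤ u a = begin
    ∣ eigλ T f (2 + u + a) a (suc (u + a)) ∣ ≡⟨ cong ∣_∣ (eigλ-d∸1 u a) ⟩
    ∣ i ℤ.+ j ∣                              ≤⟨ ℤₚ.∣i+j∣≤∣i∣+∣j∣ i j ⟩
    ∣ i ∣ + ∣ j ∣                            ≡⟨ cong₂ _+_ (∣sign*+∣ (2 + u) _) (∣sign*+∣ (suc u) _) ⟩
    A′ * q ^ choose2 (2 + u) + A * (Q * g 1) ≡⟨ cong (λ n → A′ * n + A * (Q * g 1)) (q^choose2-suc (suc u)) ⟩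
    A′ * (q ^ suc u * Q) + A * (Q * g 1)     ∎
    where
    open ℕₚ.≤-Reasoning
    A = gauss q (u + a) a
    A′ = gaussPred q (u + a) a
    Q = q ^ choose2 (suc u)
    i = sign (2 + u) ℤ.* + (A′ * q ^ choose2 (2 + u))
    j = sign (suc u) ℤ.* + (A * (Q * g 1))

-- Comparison of the absolute values

module _ (T : PolarType) (f : ℕ) (1<f : 1 < f) where

  private
    q : ℕ
    q = order T f

    g : ℕ → ℕ
    g = qPowε T f

    instance
      f≢0 : ℕ.NonZero f
      f≢0 = ℕ.>-nonZero (ℕₚ.<-trans (s≤s z≤n) 1<f)

  1≤q^ : ∀ n → 1 ≤ q ^ n
  1≤q^ n = subst (1 ≤_) (sym (order^≡f^ T f n)) (ℕₚ.m^n>0 f (fieldDegree T * n))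

  1≤g : ∀ k → 1 ≤ g k
  1≤g k = subst (1 ≤_) (sym (qPowε≡f^εDegree T f k)) (ℕₚ.m^n>0 f (k * εDegree T))

  g1≤g : ∀ k → g 1 ≤ g (suc k)
  g1≤g k = subst₂ _≤_ (sym (qPowε≡f^εDegree T f 1)) (sym (qPowε≡f^εDegree T f (suc k)))
                  (ℕₚ.^-monoʳ-≤ f (ℕₚ.*-monoˡ-≤ (εDegree T) (s≤s (z≤n {k}))))

  g1≤q^ : ∀ n → 2 ≤ n → g 1 ≤ q ^ n
  g1≤q^ n 2≤n = subst₂ _≤_ (sym (qPowε≡f^εDegree T f 1)) (sym (order^≡f^ T f n))
    (ℕₚ.^-monoʳ-≤ f (ℕₚ.≤-trans (ℕₚ.≤-reflexive (ℕₚ.*-identityˡ (εDegree T)))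
                    (ℕₚ.≤-trans (εDegree≤2*fieldDegree T) (ℕₚ.*-monoʳ-≤ (fieldDegree T) 2≤n))))

  q^<g : 2 < twoε T → ∀ k → q ^ suc k < g (suc k)
  q^<g 2<twoε k = subst₂ _<_ (sym (order^≡f^ T f (suc k))) (sym (qPowε≡f^εDegree T f (suc k)))
    (ℕₚ.^-monoʳ-< f 1<f (subst (_< suc k * εDegree T) (ℕₚ.*-comm (suc k) (fieldDegree T))
                          (ℕₚ.*-monoʳ-< (suc k) (2<twoε⇒fieldDegree<εDegree T 2<twoε))))

  g≡q^ : twoε T ≡ 2 → ∀ k → g k ≡ q ^ k
  g≡q^ twoε≡2 k = begin
    g k                         ≡⟨ qPowε≡f^εDegree T f k ⟩
    f ^ (k * εDegree T)         ≡⟨ cong (λ e → f ^ (k * e)) (twoε≡2⇒εDegree≡fieldDegree T twoε≡2) ⟩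
    f ^ (k * fieldDegree T)     ≡⟨ cong (f ^_) (ℕₚ.*-comm k (fieldDegree T)) ⟩
    f ^ (fieldDegree T * k)     ≡⟨ order^≡f^ T f k ⟨
    q ^ k                       ∎
    where open ≡-Reasoning

  g<q^ : twoε T < 2 → ∀ k → g (suc k) < q ^ suc k
  g<q^ twoε<2 k = subst₂ _<_ (sym (qPowε≡f^εDegree T f (suc k))) (sym (order^≡f^ T f (suc k)))
    (ℕₚ.^-monoʳ-< f 1<f (subst (suc k * εDegree T <_) (ℕₚ.*-comm (suc k) (fieldDegree T))
                          (ℕₚ.*-monoʳ-< (suc k) (twoε<2⇒εDegree<fieldDegree T twoε<2))))

  private
    1≤weight : ∀ u a → 1 ≤ gauss q (suc (u + a)) a * q ^ choose2 (suc u)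
    1≤weight u a = ℕₚ.*-mono-≤ (gauss-pos q (ℕₚ.≤-trans (ℕₚ.m≤n+m a u) (ℕₚ.n≤1+n (u + a)))) (1≤q^ (choose2 (suc u)))

    scale-< : ∀ {K x y} → 1 ≤ K → x < y → K * x < K * y
    scale-< {K} 1≤K = ℕₚ.*-monoʳ-< K {{ℕ.>-nonZero 1≤K}}

  ∣eigλ-d∣<∣eigλ-1∣ : 2 < twoε T → ∀ u a → ∣ eigλ T f (2 + u + a) a (2 + u + a) ∣ < ∣ eigλ T f (2 + u + a) a 1 ∣
  ∣eigλ-d∣<∣eigλ-1∣ 2<twoε u a = subst₂ _<_ (sym (∣eigλ-d∣ T f u a)) (sym (∣eigλ-1∣ T f u a))
    (scale-< (1≤weight u a) (q^<g 2<twoε u))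

  ∣eigλ-1∣≡∣eigλ-d∣ : twoε T ≡ 2 → ∀ u a → ∣ eigλ T f (2 + u + a) a 1 ∣ ≡ ∣ eigλ T f (2 + u + a) a (2 + u + a) ∣
  ∣eigλ-1∣≡∣eigλ-d∣ twoε≡2 u a = trans (∣eigλ-1∣ T f u a)
    (trans (cong (gauss q (suc (u + a)) a * q ^ choose2 (suc u) *_) (g≡q^ twoε≡2 (suc u))) (sym (∣eigλ-d∣ T f u a)))

  ∣eigλ-1∣<∣eigλ-d∣ : twoε T < 2 → ∀ u a → ∣ eigλ T f (2 + u + a) a 1 ∣ < ∣ eigλ T f (2 + u + a) a (2 + u + a) ∣
  ∣eigλ-1∣<∣eigλ-d∣ twoε<2 u a = subst₂ _<_ (sym (∣eigλ-1∣ T f u a)) (sym (∣eigλ-d∣ T f u a))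
    (scale-< (1≤weight u a) (g<q^ twoε<2 u))

  ∣eigλ-d∸1∣≤∣eigλ-1∣ : ∀ u a → ∣ eigλ T f (2 + u + a) a (suc (u + a)) ∣ ≤ ∣ eigλ T f (2 + u + a) a 1 ∣
  ∣eigλ-d∸1∣≤∣eigλ-1∣ u a = begin
    ∣ eigλ T f (2 + u + a) a (suc (u + a)) ∣            ≤⟨ ∣eigλ-d∸1∣≤ T f u a ⟩
    A′ * (x * Q) + A * (Q * g 1)                        ≤⟨ ℕₚ.+-mono-≤ (ℕₚ.m≤m*n _ (g (suc u)) {{ℕ.>-nonZero (1≤g (suc u))}})
                                                                        (ℕₚ.*-monoʳ-≤ A (ℕₚ.*-monoʳ-≤ Q (g1≤g u))) ⟩
    A′ * (x * Q) * g (suc u) + A * (Q * g (suc u))      ≡⟨ lemma A A′ x Q (g (suc u)) ⟨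
    (A + x * A′) * Q * g (suc u)                        ≡⟨ cong (λ n → n * Q * g (suc u)) (gauss-pascal′-pred q u a) ⟨
    gauss q (suc (u + a)) a * Q * g (suc u)             ≡⟨ ∣eigλ-1∣ T f u a ⟨
    ∣ eigλ T f (2 + u + a) a 1 ∣                        ∎
    where
    open ℕₚ.≤-Reasoning
    A = gauss q (u + a) a
    A′ = gaussPred q (u + a) a
    x = q ^ suc u
    Q = q ^ choose2 (suc u)
    lemma : ∀ A A′ x Q z → (A + x * A′) * Q * z ≡ A′ * (x * Q) * z + A * (Q * z)
    lemma = ℕ-Solver.solve-∀

  ∣eigλ-d∸1∣≤∣eigλ-d∣ : ∀ u a → 1 ≤ u + a → ∣ eigλ T f (2 + u + a) a (suc (u + a)) ∣ ≤ ∣ eigλ T f (2 + u + a) a (2 + u + a) ∣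
  ∣eigλ-d∸1∣≤∣eigλ-d∣ u a 1≤u+a = begin
    ∣ eigλ T f (2 + u + a) a (suc (u + a)) ∣            ≤⟨ ∣eigλ-d∸1∣≤ T f u a ⟩
    A′ * (x * Q) + A * (Q * g 1)                        ≤⟨ ℕₚ.+-monoʳ-≤ (A′ * (x * Q)) (ℕₚ.*-monoʳ-≤ A (ℕₚ.*-monoʳ-≤ Q g1≤q^a*x)) ⟩
    A′ * (x * Q) + A * (Q * (q ^ a * x))                ≡⟨ lemma A A′ x (q ^ a) Q ⟨
    (A′ + q ^ a * A) * Q * x                            ≡⟨ cong (λ n → n * Q * x) (gauss-pascal q (u + a) a) ⟨
    gauss q (suc (u + a)) a * Q * x                     ≡⟨ ∣eigλ-d∣ T f u a ⟨
    ∣ eigλ T f (2 + u + a) a (2 + u + a) ∣              ∎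
    where
    open ℕₚ.≤-Reasoning
    A = gauss q (u + a) a
    A′ = gaussPred q (u + a) a
    x = q ^ suc u
    Q = q ^ choose2 (suc u)
    g1≤q^a*x : g 1 ≤ q ^ a * x
    g1≤q^a*x = subst (g 1 ≤_) (ℕₚ.^-distribˡ-+-* q a (suc u))
                     (g1≤q^ (a + suc u) (ℕₚ.≤-trans (s≤s 1≤u+a)
                       (ℕₚ.≤-reflexive (trans (cong suc (ℕₚ.+-comm u a)) (sym (ℕₚ.+-suc a u))))))
    lemma : ∀ A A′ x y Q → (A′ + y * A) * Q * x ≡ A′ * (x * Q) + A * (Q * (y * x))
    lemma = ℕ-Solver.solve-∀

a+2≤d⇒∃u[2+u+a≡d] : ∀ {a d} → a + 2 ≤ d → ∃[ u ] 2 + u + a ≡ d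
a+2≤d⇒∃u[2+u+a≡d] {a} a+2≤d with ℕₚ.m≤n⇒∃[o]m+o≡n a+2≤d
... | u , a+2+u≡d = u , trans (ℕₚ.+-comm (2 + u) a) (trans (sym (ℕₚ.+-assoc a 2 u)) a+2+u≡d)

proposition8p4 : (T : PolarType) (f d a : ℕ) → IsPrimePower f → 3 ≤ order T f →
    a + 2 ≤ d →
    ((2 < twoε T → ∣ eigλ T f d a d ∣ < ∣ eigλ T f d a 1 ∣)
      × (twoε T ≡ 2 → ∣ eigλ T f d a 1 ∣ ≡ ∣ eigλ T f d a d ∣)
      × (twoε T < 2 → ∣ eigλ T f d a 1 ∣ < ∣ eigλ T f d a d ∣))
    × (3 ≤ d → (∣ eigλ T f d a (d ∸ 1) ∣ ≤ ∣ eigλ T f d a 1 ∣)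
      × (∣ eigλ T f d a (d ∸ 1) ∣ ≤ ∣ eigλ T f d a d ∣))
proposition8p4 T f d a _ 3≤q a+2≤d with a+2≤d⇒∃u[2+u+a≡d] a+2≤d
... | u , refl =
  ( (λ 2<twoε → ∣eigλ-d∣<∣eigλ-1∣ T f 1<f 2<twoε u a)
  , (λ twoε≡2 → ∣eigλ-1∣≡∣eigλ-d∣ T f 1<f twoε≡2 u a)
  , (λ twoε<2 → ∣eigλ-1∣<∣eigλ-d∣ T f 1<f twoε<2 u a) )
  , λ 3≤d → ∣eigλ-d∸1∣≤∣eigλ-1∣ T f 1<f u a , ∣eigλ-d∸1∣≤∣eigλ-d∣ T f 1<f u a (ℕₚ.≤-pred (ℕₚ.≤-pred 3≤d))
  where
  1<f : 1 < f
  1<f = 3≤order⇒2≤f T f 3≤q
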